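{- Let $S$ be a set of states, $I\subseteq S$ a set of initial states, $T\subseteq S\times S$ a transition relation that is total (for every $s\in S$ there is $s'\in S$ with $(s,s')\in T$), and $P\subseteq S$ a property. Define $\Phi\colon 2^S\to 2^S$, $\Phi(X)=I\cup\mathrm{Succs}(X)$ with $\mathrm{Succs}(X)=\{t'\mid\exists t\in X\colon (t,t')\in T\}$, and $\Psi_P\colon 2^S\to 2^S$, $\Psi_P(X)=\Phi(X)\cap P$. Then for every natural number $k\ge 1$: $\Phi(\Psi_P^{k-1}(P))\subseteq P$ if and only if both of the following formulae are valid: (init) $I(s_1)\wedge T(s_1,s_2)\wedge\dots\wedge T(s_{k-1},s_k)\implies P(s_1)\wedge\dots\wedge P(s_k)$; (step) $P(s_1)\wedge T(s_1,s_2)\wedge P(s_2)\wedge\dots\wedge T(s_{k-1},s_k)\wedge P(s_k)\wedge T(s_k,s_{k+1})\implies P(s_{k+1})$.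
   Context: $\Psi_P^{j}$ denotes $j$-fold iteration of $\Psi_P$ ($\Psi_P^0(P)=P$). In the formulae, $s_1,\dots,s_{k+1}$ are variables ranging over states, and $I(s)$, $T(s,s')$, $P(s)$ are relation symbols interpreted as $I$, $T$, $P$ respectively (so an interpretation $\mu$ assigning states to variables satisfies $I(s)$ iff $\mu(s)\in I$, $T(s,s')$ iff $(\mu(s),\mu(s'))\in T$, $P(s)$ iff $\mu(s)\in P$). A formula is valid if it is satisfied by every such interpretation. The lattice is $(2^S,\subseteq)$. -}

module Defs where

open import Level using (0ℓ)
open import Data.Nat using (ℕ; zero; suc)
open import Data.Fin using (Fin; zero; suc; inject₁; fromℕ)
open import Data.Product using (∃; _×_; _,_)
open import Relation.Unary using (Pred; _∪_; _∩_; _⊆_)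

Total : {S : Set} → (S → S → Set) → Set
Total {S} T = ∀ (s : S) → ∃ λ s' → T s s'

Succs : {S : Set} → (S → S → Set) → Pred S 0ℓ → Pred S 0ℓ
Succs T X t' = ∃ λ t → X t × T t t'

Φ : {S : Set} → Pred S 0ℓ → (S → S → Set) → Pred S 0ℓ → Pred S 0ℓ
Φ I T X = I ∪ Succs T X

Ψ : {S : Set} → Pred S 0ℓ → (S → S → Set) → Pred S 0ℓ → Pred S 0ℓ → Pred S 0ℓ
Ψ I T P X = Φ I T X ∩ P

iter : {A : Set₁} → ℕ → (A → A) → A → A
iter zero    f x = x
iter (suc j) f x = f (iter j f x)

-- (init) for k = suc n variables s₀ … sₙ (interpretation μ : Fin k → S):
-- I(s₁) ∧ T(s₁,s₂) ∧ … ∧ T(s_{k-1},s_k) ⟹ P(s₁) ∧ … ∧ P(s_k)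
InitValid : {S : Set} → Pred S 0ℓ → (S → S → Set) → Pred S 0ℓ → ℕ → Set
InitValid {S} I T P n =
  ∀ (s : Fin (suc n) → S) →
    I (s zero) →
    (∀ (i : Fin n) → T (s (inject₁ i)) (s (suc i))) →
    ∀ (i : Fin (suc n)) → P (s i)

-- (step) for k = suc n, variables s₀ … s_{k} (interpretation μ : Fin (k+1) → S):
-- P(s₁) ∧ T(s₁,s₂) ∧ P(s₂) ∧ … ∧ P(s_k) ∧ T(s_k,s_{k+1}) ⟹ P(s_{k+1})
StepValid : {S : Set} → (S → S → Set) → Pred S 0ℓ → ℕ → Set
StepValid {S} T P n =
  ∀ (s : Fin (suc (suc n)) → S) →
    (∀ (i : Fin (suc n)) → P (s (inject₁ i))) →
    (∀ (i : Fin (suc n)) → T (s (inject₁ i)) (s (suc i))) →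
    P (s (fromℕ (suc n)))

-- Ψⁿ(P) consists of the P-states reached by a P-path that starts in I or has n steps.
-- If Φ(Ψⁿ(P)) ⊆ P, then Ψⁿ⁺¹(P) ⊆ Ψⁿ(P) makes Ψⁿ(P) an inductive invariant containing I,
-- which gives (init), while the end of any n-step P-path lies in Ψⁿ(P), which gives (step).
-- Conversely, unfold membership in Ψⁿ(P) backwards into a P-path: if it reaches I early,
-- extend it forward by totality and apply (init), otherwise apply (step).
module Submission where

open import Defs
open import Level using (0ℓ)
open import Data.Nat using (ℕ; zero; suc; _+_; _≤_; _<_; z≤n; s≤s)
open import Data.Nat.Properties using (+-suc; +-identityʳ; m≤n+m; ≤-refl)
open import Data.Fin using (Fin; zero; suc; inject₁; fromℕ; toℕ; fromℕ<)
open import Data.Fin.Properties using (toℕ<n; toℕ≤pred[n]; toℕ-inject₁; toℕ-fromℕ; toℕ-fromℕ<)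
open import Data.Product using (_×_; _,_; proj₁; proj₂)
open import Data.Sum using (inj₁; inj₂)
open import Function using (_∘_; const)
open import Function.Bundles using (_⇔_; mk⇔)
open import Relation.Unary using (Pred; _⊆_)
open import Relation.Binary.PropositionalEquality using (_≡_; refl; subst; sym; trans)

iter-descending : {S : Set} (f : Pred S 0ℓ → Pred S 0ℓ) →
  (∀ {X Y} → X ⊆ Y → f X ⊆ f Y) → ∀ {X} → f X ⊆ X →
  ∀ j → iter (suc j) f X ⊆ iter j f X
iter-descending f mono fX⊆X zero    = fX⊆X
iter-descending f mono fX⊆X (suc j) = mono (iter-descending f mono fX⊆X j)

module Paths {S : Set} (T : S → S → Set) where

  FinChain : ∀ m → (Fin (suc m) → S) → Set
  FinChain m s = ∀ (i : Fin m) → T (s (inject₁ i)) (s (suc i))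

  Chain : ℕ → (ℕ → S) → Set
  Chain m f = ∀ k → k < m → T (f k) (f (suc k))

  All≤ : Pred S 0ℓ → ℕ → (ℕ → S) → Set
  All≤ Q m f = ∀ k → k ≤ m → Q (f k)

  _◂_ : S → (ℕ → S) → ℕ → S
  (x ◂ f) zero    = x
  (x ◂ f) (suc k) = f k

  All≤-◂ : ∀ {Q x m f} → Q x → All≤ Q m f → All≤ Q (suc m) (x ◂ f)
  All≤-◂ qx qf zero    _         = qx
  All≤-◂ qx qf (suc k) (s≤s k≤m) = qf k k≤m

  Chain-◂ : ∀ {x m f} → T x (f 0) → Chain m f → Chain (suc m) (x ◂ f)
  Chain-◂ t c zero    _         = t
  Chain-◂ t c (suc k) (s≤s k<m) = c k k<m

  invariant-along : (Q : Pred S 0ℓ) → (∀ {x y} → Q x → T x y → Q y) →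
    ∀ m (s : Fin (suc m) → S) → Q (s zero) → FinChain m s → ∀ i → Q (s i)
  invariant-along Q closed m       s q c zero    = q
  invariant-along Q closed (suc m) s q c (suc i) =
    invariant-along Q closed m (s ∘ suc) (closed q (c zero)) (c ∘ suc) i

  restrict-chain : ∀ {m} f → Chain m f → FinChain m (f ∘ toℕ)
  restrict-chain f c i rewrite toℕ-inject₁ i = c (toℕ i) (toℕ<n i)

  module Extension (total : Total T) where

    walk : S → ℕ → S
    walk x zero    = x
    walk x (suc k) = proj₁ (total (walk x k))

    walk-chain : ∀ x k → T (walk x k) (walk x (suc k))
    walk-chain x k = proj₂ (total (walk x k))

    extend : ℕ → (ℕ → S) → ℕ → S
    extend zero    f         = walk (f 0)
    extend (suc m) f zero    = f 0
    extend (suc m) f (suc k) = extend m (f ∘ suc) k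

    extend-agrees : ∀ m f k → k ≤ m → extend m f k ≡ f k
    extend-agrees zero    f zero    z≤n       = refl
    extend-agrees (suc m) f zero    _         = refl
    extend-agrees (suc m) f (suc k) (s≤s k≤m) = extend-agrees m (f ∘ suc) k k≤m

    extend-chain : ∀ m f → Chain m f → ∀ k → T (extend m f k) (extend m f (suc k))
    extend-chain zero    f c = walk-chain (f 0)
    extend-chain (suc m) f c zero =
      subst (T (f 0)) (sym (extend-agrees m (f ∘ suc) 0 z≤n)) (c 0 (s≤s z≤n))
    extend-chain (suc m) f c (suc k) =
      extend-chain m (f ∘ suc) (λ k k<m → c (suc k) (s≤s k<m)) k

module _ {S : Set} (I : Pred S 0ℓ) (T : S → S → Set) (P : Pred S 0ℓ) where

  open Paths T

  Ψ^_ : ℕ → Pred S 0ℓ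
  Ψ^ j = iter j (Ψ I T P) P

  Ψ^⊆P : ∀ j → Ψ^ j ⊆ P
  Ψ^⊆P zero    x∈ = x∈
  Ψ^⊆P (suc j) x∈ = proj₂ x∈

  Ψ-mono : ∀ {X Y} → X ⊆ Y → Ψ I T P X ⊆ Ψ I T P Y
  Ψ-mono X⊆Y (inj₁ i               , p) = inj₁ i , p
  Ψ-mono X⊆Y (inj₂ (x , x∈X , t) , p) = inj₂ (x , X⊆Y x∈X , t) , p

  Ψ^-descending : ∀ j → Ψ^ suc j ⊆ Ψ^ j
  Ψ^-descending = iter-descending (Ψ I T P) Ψ-mono proj₂

  P-chain-ends-in-Ψ^ : ∀ n (s : Fin (suc n) → S) → (∀ i → P (s i)) →
    FinChain n s → (Ψ^ n) (s (fromℕ n))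
  P-chain-ends-in-Ψ^ zero    s p c = p zero
  P-chain-ends-in-Ψ^ (suc n) s p c =
    inj₂ (s (inject₁ (fromℕ n)) ,
          P-chain-ends-in-Ψ^ n (s ∘ inject₁) (p ∘ inject₁) (c ∘ inject₁) ,
          c (fromℕ n)) ,
    p (suc (fromℕ n))

  InitValid⇒ : ∀ {n} → InitValid I T P n →
    ∀ f → I (f 0) → Chain n f → All≤ P n f
  InitValid⇒ init f i c k k≤n =
    subst (P ∘ f) (toℕ-fromℕ< (s≤s k≤n))
      (init (f ∘ toℕ) i (restrict-chain f c) (fromℕ< (s≤s k≤n)))

  StepValid⇒ : ∀ {n} → StepValid T P n →
    ∀ f → All≤ P n f → Chain (suc n) f → P (f (suc n))
  StepValid⇒ {n} step f p c =
    subst (P ∘ f) (toℕ-fromℕ (suc n))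
      (step (f ∘ toℕ)
            (λ i → subst (P ∘ f) (sym (toℕ-inject₁ i)) (p (toℕ i) (toℕ≤pred[n] i)))
            (restrict-chain f c))

  Φ-Ψ^⊆P⇒valid : ∀ n → Φ I T (Ψ^ n) ⊆ P → InitValid I T P n × StepValid T P n
  Φ-Ψ^⊆P⇒valid n Φ⊆P =
      (λ s i c k → Ψ^⊆P n (invariant-along (Ψ^ n) closed n s (Φ⊆Ψ^ (inj₁ i)) c k))
    , (λ s p c → Φ⊆P (inj₂ (_ , P-chain-ends-in-Ψ^ n (s ∘ inject₁) p (c ∘ inject₁) ,
                             c (fromℕ n))))
    where
      Φ⊆Ψ^ : Φ I T (Ψ^ n) ⊆ Ψ^ n
      Φ⊆Ψ^ x∈ = Ψ^-descending n (x∈ , Φ⊆P x∈)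

      closed : ∀ {x y} → (Ψ^ n) x → T x y → (Ψ^ n) y
      closed x∈ t = Φ⊆Ψ^ (inj₂ (_ , x∈ , t))

  module _ (total : Total T) {n} (init : InitValid I T P n) (step : StepValid T P n) where

    open Extension total

    P-chain-from-Ψ^-ends-in-P : ∀ j d → j + d ≡ n → ∀ f → (Ψ^ j) (f 0) →
      All≤ P d f → Chain (suc d) f → P (f (suc d))
    P-chain-from-Ψ^-ends-in-P zero d refl f _ p c = StepValid⇒ step f p c
    P-chain-from-Ψ^-ends-in-P (suc j) d refl f (inj₁ i , _) p c =
      subst P (extend-agrees (suc d) f (suc d) ≤-refl)
        (InitValid⇒ init (extend (suc d) f) i (λ k _ → extend-chain (suc d) f c k)
                    (suc d) (s≤s (m≤n+m d j)))
    P-chain-from-Ψ^-ends-in-P (suc j) d eq f (inj₂ (x , x∈ , t) , _) p c =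
      P-chain-from-Ψ^-ends-in-P j (suc d) (trans (+-suc j d) eq) (x ◂ f) x∈
        (All≤-◂ {Q = P} (Ψ^⊆P j x∈) p) (Chain-◂ t c)

    valid⇒Φ-Ψ^⊆P : Φ I T (Ψ^ n) ⊆ P
    valid⇒Φ-Ψ^⊆P (inj₁ i) = InitValid⇒ init (walk _) i (λ k _ → walk-chain _ k) 0 z≤n
    valid⇒Φ-Ψ^⊆P {y} (inj₂ (x , x∈ , t)) =
      P-chain-from-Ψ^-ends-in-P n 0 (+-identityʳ n) (x ◂ const y) x∈
        (λ { zero z≤n → Ψ^⊆P n x∈ }) (Chain-◂ t λ _ ())

theorem4 : {S : Set} (I : Pred S 0ℓ) (T : S → S → Set) (P : Pred S 0ℓ) →
    Total T →
    ∀ (n : ℕ) →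
      (Φ I T (iter n (Ψ I T P) P) ⊆ P) ⇔ (InitValid I T P n × StepValid T P n)
theorem4 I T P total n =
  mk⇔ (Φ-Ψ^⊆P⇒valid I T P n)
      (λ (init , step) → valid⇒Φ-Ψ^⊆P I T P total init step)
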